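{- Let $G=(A\cup B,E)$ be a brace and $X\subseteq V(G)$ with $\operatorname{mp}(\partial(X))=2$ and $4\le|X|\le|V(G)|-4$. Then no vertex of the minority of $X$ has a neighbour in $V(G)\setminus X$.
   Context: All graphs are finite and simple. $\mathcal{M}(G)$ is the set of perfect matchings of $G$; $G$ is matching covered if connected and every edge lies in a perfect matching. For nonempty $X\subseteq V(G)$, $\partial(X)$ is the set of edges with exactly one endpoint in $X$, and $\operatorname{mp}(\partial(X))=\max_{M\in\mathcal{M}(G)}|M\cap\partial(X)|$. A cut $\partial(Z)$ is tight if $|M\cap\partial(Z)|=1$ for all $M\in\mathcal{M}(G)$, nontrivial if both shores have at least two vertices; a brace is a bipartite matching covered graph (colour classes $A,B$) with no nontrivial tight cut. For $X\subseteq V(G)$, if $|A\cap X|>|B\cap X|$ then $A$ is the majority and $B$ the minority of $X$ (and symmetrically); the minority of $X$ here refers to the vertices of $X$ in the minority colour class. -}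

module Defs where

open import Data.Nat using (ℕ; zero; suc; _+_; _≤_; _<_)
open import Data.Fin using (Fin; zero; suc)
open import Data.Bool using (Bool; true; false; if_then_else_; _∧_; not)
open import Data.Product using (Σ; _×_; _,_; ∃)
open import Data.Empty using (⊥)
open import Relation.Nullary using (¬_)
open import Relation.Binary.PropositionalEquality using (_≡_; _≢_)

record Graph (n : ℕ) : Set₁ where
  field
    Adj     : Fin n → Fin n → Set
    sym     : ∀ {u v} → Adj u v → Adj v u
    irrefl  : ∀ {v} → ¬ Adj v v
open Graph public

VSet : ℕ → Set
VSet n = Fin n → Bool

count : ∀ {n} → VSet n → ℕ
count {zero}  p = 0
count {suc n} p = (if p zero then 1 else 0) + count (λ i → p (suc i))

compl : ∀ {n} → VSet n → VSet n
compl X v = not (X v)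

-- A perfect matching, represented by its partner map: a fixed-point-free
-- involution m with every pair {v , m v} an edge.  (The edge set of the
-- matching is {{v , m v}}; this is in bijection with perfect matchings.)
record PerfectMatching {n : ℕ} (G : Graph n) : Set where
  field
    mate     : Fin n → Fin n
    mate-adj : ∀ v → Adj G v (mate v)
    mate-inv : ∀ v → mate (mate v) ≡ v
open PerfectMatching public

-- |M ∩ ∂(X)|: each edge of M in ∂(X) has exactly one endpoint in X,
-- so it is counted by that endpoint.
cutCount : ∀ {n} {G : Graph n} → PerfectMatching G → VSet n → ℕ
cutCount M X = count (λ v → X v ∧ not (X (mate M v)))

InMatching : ∀ {n} {G : Graph n} → PerfectMatching G → Fin n → Fin n → Set
InMatching M u v = mate M u ≡ v

MpEq : ∀ {n} (G : Graph n) → VSet n → ℕ → Set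
MpEq G X k =
  Σ (PerfectMatching G) (λ M → cutCount M X ≡ k) ×
  (∀ (M : PerfectMatching G) → cutCount M X ≤ k)

data Reach {n : ℕ} (G : Graph n) : Fin n → Fin n → Set where
  here : ∀ {v} → Reach G v v
  step : ∀ {u v w} → Adj G u v → Reach G v w → Reach G u w

Connected : ∀ {n} → Graph n → Set
Connected G = ∀ u v → Reach G u v

MatchingCovered : ∀ {n} → Graph n → Set
MatchingCovered G =
  Connected G ×
  (∀ u v → Adj G u v → Σ (PerfectMatching G) (λ M → InMatching M u v))

-- G is bipartite with colour classes A = {v | col v ≡ true}, B = {v | col v ≡ false}
ProperColouring : ∀ {n} → Graph n → (Fin n → Bool) → Set
ProperColouring G col = ∀ u v → Adj G u v → col u ≢ col v

Tight : ∀ {n} (G : Graph n) → VSet n → Set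
Tight G Z = ∀ (M : PerfectMatching G) → cutCount M Z ≡ 1

Nontrivial : ∀ {n} → VSet n → Set
Nontrivial Z = 2 ≤ count Z × 2 ≤ count (compl Z)

Brace : ∀ {n} (G : Graph n) → (Fin n → Bool) → Set
Brace {n} G col =
  ProperColouring G col ×
  MatchingCovered G ×
  (∀ (Z : VSet n) → Nontrivial Z → ¬ Tight G Z)

colourPart : ∀ {n} → (Fin n → Bool) → Bool → VSet n → VSet n
colourPart col true  X v = X v ∧ col v
colourPart col false X v = X v ∧ not (col v)

-- Take a perfect matching M through the edge vu.  Inside X, M pairs minority vertices
-- with majority vertices, so the majority of X has strictly more vertices matched out of X
-- than the minority does.  The minority vertex v is matched out of X, hence at least
-- 1 + 2 = 3 edges of M lie in ∂(X), contradicting mp(∂(X)) = 2.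
module Submission where

open import Defs hiding (sym)
open import Algebra.Bundles using (CommutativeMonoid)
open import Data.Bool using (Bool; true; false; not; _∧_; if_then_else_)
open import Data.Bool.Properties using (∧-commutativeMonoid; ¬-not; not-involutive)
open import Data.Fin using (Fin; zero; suc)
open import Data.Fin.Permutation using (permutation)
open import Data.Nat using (ℕ; zero; suc; _≤_; _<_; _+_; s≤s; z≤n)
open import Data.Nat.Properties
  using (+-0-commutativeMonoid; +-comm; +-cancelˡ-<; +-mono-≤; ≤-trans; m≤n+m)
open import Data.Product using (_,_)
open import Function using (_∘_)
open import Relation.Nullary using (¬_)
open import Relation.Binary.PropositionalEquality
  using (_≡_; refl; sym; trans; cong; cong₂; subst; subst₂; ≢-sym; module ≡-Reasoning)

open import Algebra.Properties.CommutativeMonoid.Sum +-0-commutativeMonoid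
  using (sum; sum-permute)
open import Algebra.Properties.CommutativeSemigroup
  (CommutativeMonoid.commutativeSemigroup ∧-commutativeMonoid)
  using (xy∙z≈xz∙y; xy∙z≈zy∙x)
open import Algebra.Properties.CommutativeSemigroup
  (CommutativeMonoid.commutativeSemigroup +-0-commutativeMonoid)
  using () renaming (interchange to +-interchange)

indicator : Bool → ℕ
indicator b = if b then 1 else 0

count≡sum : ∀ {n} (p : VSet n) → count p ≡ sum (indicator ∘ p)
count≡sum {zero}  p = refl
count≡sum {suc n} p = cong (indicator (p zero) +_) (count≡sum (p ∘ suc))

count-cong : ∀ {n} {p q : VSet n} → (∀ v → p v ≡ q v) → count p ≡ count q
count-cong {zero}  eq = refl
count-cong {suc n} eq = cong₂ _+_ (cong indicator (eq zero)) (count-cong (eq ∘ suc))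

indicator-∧-split : ∀ a b → indicator a ≡ indicator (a ∧ b) + indicator (a ∧ not b)
indicator-∧-split false b     = refl
indicator-∧-split true  false = refl
indicator-∧-split true  true  = refl

count-∧-split : ∀ {n} (p q : VSet n) →
  count p ≡ count (λ v → p v ∧ q v) + count (λ v → p v ∧ not (q v))
count-∧-split {zero}  p q = refl
count-∧-split {suc n} p q
  rewrite indicator-∧-split (p zero) (q zero) | count-∧-split (p ∘ suc) (q ∘ suc) =
    +-interchange (indicator (p zero ∧ q zero)) (indicator (p zero ∧ not (q zero))) _ _

count-positive : ∀ {n} (p : VSet n) v → p v ≡ true → 1 ≤ count p
count-positive p zero    pv rewrite pv = s≤s z≤n
count-positive p (suc v) pv =
  ≤-trans (count-positive (p ∘ suc) v pv) (m≤n+m _ (indicator (p zero)))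

count-involution : ∀ {n} (f : Fin n → Fin n) → (∀ v → f (f v) ≡ v) →
  (p : VSet n) → count p ≡ count (p ∘ f)
count-involution f f-inv p = begin
  count p                     ≡⟨ count≡sum p ⟩
  sum (indicator ∘ p)         ≡⟨ sum-permute (indicator ∘ p) (permutation f f f-inv f-inv) ⟩
  sum (indicator ∘ p ∘ f)     ≡⟨ sym (count≡sum (p ∘ f)) ⟩
  count (p ∘ f)               ∎
  where open ≡-Reasoning

module BipartiteMatching {n} {G : Graph n} {col : Fin n → Bool}
  (proper : ProperColouring G col) (M : PerfectMatching G) (X : VSet n) where

  private
    m = mate M

  matchedInside : Bool → VSet n
  matchedInside c w = colourPart col c X w ∧ X (m w)

  matchedOutside : Bool → VSet n
  matchedOutside c w = colourPart col c X w ∧ not (X (m w))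

  mate-colour : ∀ w → col (m w) ≡ not (col w)
  mate-colour w = ¬-not (≢-sym (proper w (m w) (mate-adj M w)))

  matchedOutside-own-colour : ∀ {w} → X w ≡ true → X (m w) ≡ false →
    matchedOutside (col w) w ≡ true
  matchedOutside-own-colour {w} Xw Xmw rewrite Xmw with col w in colw
  ... | true  rewrite Xw | colw = refl
  ... | false rewrite Xw | colw = refl

  colourPart-split : ∀ c →
    count (colourPart col c X) ≡ count (matchedInside c) + count (matchedOutside c)
  colourPart-split c = count-∧-split (colourPart col c X) (X ∘ m)

  colourPart-swap : ∀ c {u w} → col u ≡ not (col w) →
    colourPart col (not c) X u ∧ X w ≡ colourPart col c X w ∧ X u
  colourPart-swap true  {u} {w} eq rewrite eq | not-involutive (col w) =
    xy∙z≈zy∙x (X u) (col w) (X w)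
  colourPart-swap false {u} {w} eq rewrite eq =
    xy∙z≈zy∙x (X u) (not (col w)) (X w)

  matchedInside-balanced : ∀ c → count (matchedInside (not c)) ≡ count (matchedInside c)
  matchedInside-balanced c = trans (count-involution m (mate-inv M) (matchedInside (not c)))
    (count-cong swap)
    where
    swap : ∀ w → matchedInside (not c) (m w) ≡ matchedInside c w
    swap w rewrite mate-inv M w = colourPart-swap c (mate-colour w)

  cutCount-split : ∀ c →
    cutCount M X ≡ count (matchedOutside c) + count (matchedOutside (not c))
  cutCount-split true  = trans (count-∧-split _ col)
    (cong₂ _+_ (count-cong λ w → xy∙z≈xz∙y (X w) _ (col w))
               (count-cong λ w → xy∙z≈xz∙y (X w) _ (not (col w))))
  cutCount-split false = trans (cutCount-split true) (+-comm (count (matchedOutside true)) _)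

  colourPart-<⇒matchedOutside-< : ∀ c →
    count (colourPart col c X) < count (colourPart col (not c) X) →
    count (matchedOutside c) < count (matchedOutside (not c))
  colourPart-<⇒matchedOutside-< c lt = +-cancelˡ-< (count (matchedInside c)) _ _
    (subst₂ _<_ (colourPart-split c)
      (trans (colourPart-split (not c))
        (cong (_+ count (matchedOutside (not c))) (matchedInside-balanced c))) lt)

lemma13 : ∀ {n : ℕ} (G : Graph n) (col : Fin n → Bool) (X : VSet n) →
    Brace G col →
    MpEq G X 2 →
    4 ≤ count X →
    count X + 4 ≤ n →
    ∀ (c : Bool) →
    count (colourPart col c X) < count (colourPart col (not c) X) →
    ∀ (v u : Fin n) → X v ≡ true → col v ≡ c → X u ≡ false →
    ¬ Adj G v u
lemma13 G col X (proper , (_ , cover) , _) (_ , mp≤2) _ _ c minority v u Xv colv Xu vu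
  with cover v u vu
... | M , mv≡u = three≰two (≤-trans three≤cut (mp≤2 M))
  where
  open BipartiteMatching proper M X

  one≤ : 1 ≤ count (matchedOutside c)
  one≤ = count-positive (matchedOutside c) v
    (subst (λ d → matchedOutside d v ≡ true) colv
      (matchedOutside-own-colour Xv (trans (cong X mv≡u) Xu)))

  three≤cut : 3 ≤ cutCount M X
  three≤cut = subst (3 ≤_) (sym (cutCount-split c))
    (+-mono-≤ one≤ (≤-trans (s≤s one≤) (colourPart-<⇒matchedOutside-< c minority)))

  three≰two : ¬ 3 ≤ 2
  three≰two (s≤s (s≤s ()))
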